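{- Let $(S,+)$ be a commutative semigroup, let $p$ be an idempotent in $(\beta S,+)$, and let $\langle C_n\rangle_{n=1}^\infty$ be a sequence of members of $p$. Then there exists, for each $i\in\mathbb{N}$, a sequence $\langle x_{i,j}\rangle_{j=1}^\infty$ in $S$ with $\mathrm{FS}(\langle x_{i,j}\rangle_{j=1}^\infty)\subseteq C_i$, such that for each $F\in\mathcal{P}_f(\mathbb{N})$, \[\sum_{i\in F}\langle x_{i,j}\rangle_{j=1}^\infty\subseteq C_{\min F}.\]
   Context: $\beta S$ is the Stone–Čech compactification of the discrete semigroup $S$ (the set of ultrafilters on $S$), with the operation extending $+$ given by $A\in p+q$ iff $\{x\in S: -x+A\in q\}\in p$, where $-x+A=\{y\in S: x+y\in A\}$; $p$ is idempotent if $p+p=p$. $\mathcal{P}_f(\mathbb{N})$ is the set of nonempty finite subsets of $\mathbb{N}$. For a sequence $\langle x_n\rangle_{n=1}^\infty$ in $S$, $\mathrm{FS}(\langle x_n\rangle_{n=1}^\infty)=\{\sum_{n\in H}x_n: H\in\mathcal{P}_f(\mathbb{N})\}$. For a finite nonempty $F\subseteq\mathbb{N}$ and sequences $Y_i$ ($i\in F$), $\sum_{i\in F}Y_i$ denotes the set of all sums $\sum_{i\in F}a_i$ where, for each $i\in F$, $a_i$ is some term of the sequence $Y_i$. -}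

module Defs where

open import Level using (0ℓ)
open import Data.Nat using (ℕ; _<_)
open import Data.List using (List; []; _∷_)
open import Data.Product using (Σ; _×_)
open import Data.Sum using (_⊎_)
open import Data.Unit using (⊤)
open import Relation.Unary using (Pred; _⊆_; _∩_; ∁)

-- Subsets of a type S are predicates S → Set.
-- An ultrafilter on S (i.e. a point of βS) is a family p of subsets
-- (p A means A ∈ p) which is a proper filter and is maximal.
record IsUltrafilter {S : Set} (p : Pred S 0ℓ → Set) : Set₁ where
  field
    upward    : ∀ (A B : Pred S 0ℓ) → A ⊆ B → p A → p B
    inter     : ∀ (A B : Pred S 0ℓ) → p A → p B → p (A ∩ B)
    whole     : p (λ _ → ⊤)
    inhabited : ∀ (A : Pred S 0ℓ) → p A → Σ S A
    ultra     : ∀ (A : Pred S 0ℓ) → p A ⊎ p (∁ A)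

-- -x + A = { y : x + y ∈ A }
shift : {S : Set} → (S → S → S) → S → Pred S 0ℓ → Pred S 0ℓ
shift _+_ x A = λ y → A (x + y)

plusβ : {S : Set} → (S → S → S) → (Pred S 0ℓ → Set) → (Pred S 0ℓ → Set) → Pred S 0ℓ → Set
plusβ _+_ p q A = p (λ x → q (shift _+_ x A))

IsIdempotentβ : {S : Set} → (S → S → S) → (Pred S 0ℓ → Set) → Set₁
IsIdempotentβ {S} _+_ p = ∀ (A : Pred S 0ℓ) → (plusβ _+_ p p A → p A) × (p A → plusβ _+_ p p A)

Increasing : List ℕ → Set
Increasing []           = ⊤
Increasing (a ∷ [])     = ⊤
Increasing (a ∷ b ∷ t)  = (a < b) × Increasing (b ∷ t)

-- P_f(ℕ): nonempty finite subsets of ℕ, represented canonically as a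
-- strictly increasing nonempty list  hd < t₁ < t₂ < ...
record Pf : Set where
  constructor pf
  field
    hd   : ℕ
    tl   : List ℕ
    incr : Increasing (hd ∷ tl)
open Pf public

minPf : Pf → ℕ
minPf F = hd F

sumList : {S : Set} → (S → S → S) → (ℕ → S) → ℕ → List ℕ → S
sumList _+_ g h []       = g h
sumList _+_ g h (k ∷ t)  = g h + sumList _+_ g k t

sumPf : {S : Set} → (S → S → S) → (ℕ → S) → Pf → S
sumPf _+_ g F = sumList _+_ g (hd F) (tl F)

-- Inside an idempotent ultrafilter p every member A contains the member
-- A⋆ = {x ∈ A : -x + A ∈ p}, and -x + A⋆ ∈ p for every x ∈ A⋆. Iterating
-- this yields one sequence y and a decreasing chain B₀ ⊇ B₁ ⊇ ⋯ of members
-- with Bₙ ⊆ Cₙ, yₙ ∈ Bₙ and Bₙ₊₁ ⊆ -yₙ + Bₙ, so every sum of yₖ over a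
-- finite set of indices ≥ n lies in Bₙ. Commutativity makes the order of
-- summation irrelevant, and x i j = y (pair i j) for an injective pairing with
-- pair i j ≥ i then serves both rows and transversals.
module Submission where

open import Defs
open import Level using (0ℓ)
open import Function using (_∘_)
open import Data.Nat using (ℕ; zero; suc; _+_; _≤_; _<_; _≤′_; ≤′-refl; ≤′-step; z≤n; s≤s)
open import Data.Nat.Properties
open import Data.Product using (Σ; Σ-syntax; _×_; _,_; proj₁; proj₂)
open import Data.Unit using (⊤)
open import Data.List using (List; []; _∷_; foldr; map)
open import Data.List.Relation.Unary.All using (All; _∷_)
import Data.List.Relation.Unary.All as All
import Data.List.Relation.Unary.All.Properties as All
open import Data.List.Relation.Unary.AllPairs using (_∷_)
import Data.List.Relation.Unary.AllPairs as AllPairs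
open import Data.List.Relation.Unary.Linked using (Linked; []; [-]; _∷_)
open import Data.List.Relation.Unary.Linked.Properties using (Linked⇒AllPairs)
open import Data.List.Relation.Unary.Unique.Propositional using (Unique)
import Data.List.Relation.Unary.Unique.Propositional.Properties as Unique
open import Data.List.Relation.Binary.Permutation.Propositional using (_↭_; ↭-sym; ↭⇒↭ₛ; ↭⇒↭ₛ′)
open import Data.List.Relation.Binary.Permutation.Propositional.Properties
  using (↭-empty-inv; All-resp-↭) renaming (map⁺ to ↭-map⁺)
import Data.List.Relation.Binary.Permutation.Setoid.Properties as ↭ₛ
open import Data.List.Sort ≤-decTotalOrder using (sort; sort-↭; sort-↗)
open import Relation.Unary using (Pred; _⊆_; _∩_)
open import Relation.Binary using (Setoid; tri<; tri≈; tri>)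
open import Relation.Binary.PropositionalEquality
open import Relation.Nullary using (contradiction)
open import Algebra.Definitions using (Associative; Commutative)
open import Algebra.Structures using (IsCommutativeSemigroup; IsCommutativeMonoid)
open import Algebra.Construct.Add.Identity using (liftOp; isMonoid)
open import Relation.Nullary.Construct.Add.Point using (Pointed; [_]; ∙)
open import Relation.Binary.Construct.Add.Point.Equality
  using (∙≈∙; ≈∙-isEquivalence; [≈]-injective) renaming (_≈∙_ to Lift≡; [_] to lift)

module _ {S : Set} {_⊕_ : S → S → S} (isCS : IsCommutativeSemigroup _≡_ _⊕_) where

  open IsCommutativeSemigroup isCS using (comm; isSemigroup)

  -- Adjoining an identity turns the nonempty sums into monoid folds, for
  -- which the library knows invariance under permutations.
  private
    _⊕∙_ : Pointed S → Pointed S → Pointed S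
    _⊕∙_ = liftOp _⊕_

    ⊕∙-comm : Commutative (Lift≡ _≡_) _⊕∙_
    ⊕∙-comm [ a ] [ b ] = lift (comm a b)
    ⊕∙-comm [ a ] ∙     = lift refl
    ⊕∙-comm ∙     [ b ] = lift refl
    ⊕∙-comm ∙     ∙     = ∙≈∙

    ⊕∙-setoid : Setoid 0ℓ 0ℓ
    ⊕∙-setoid = record { isEquivalence = ≈∙-isEquivalence (_≡_ {A = S}) isEquivalence }

    ⊕∙-isCommutativeMonoid : IsCommutativeMonoid (Lift≡ _≡_) _⊕∙_ ∙
    ⊕∙-isCommutativeMonoid = record { isMonoid = isMonoid isSemigroup ; comm = ⊕∙-comm }

    foldr-⊕∙≡[sumList] : ∀ (g : ℕ → S) a t →
      foldr _⊕∙_ ∙ (map (λ k → [ g k ]) (a ∷ t)) ≡ [ sumList _⊕_ g a t ]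
    foldr-⊕∙≡[sumList] g a []      = refl
    foldr-⊕∙≡[sumList] g a (b ∷ t) = cong ([ g a ] ⊕∙_) (foldr-⊕∙≡[sumList] g b t)

  sumList-↭ : ∀ (g : ℕ → S) {a b t u} → a ∷ t ↭ b ∷ u → sumList _⊕_ g a t ≡ sumList _⊕_ g b u
  sumList-↭ g {a} {b} {t} {u} σ = [≈]-injective _≡_
    (subst₂ (Lift≡ _≡_) (foldr-⊕∙≡[sumList] g a t) (foldr-⊕∙≡[sumList] g b u)
      (↭ₛ.foldr-commMonoid ⊕∙-setoid ⊕∙-isCommutativeMonoid
        (↭⇒↭ₛ′ (≈∙-isEquivalence (_≡_ {A = S}) isEquivalence) (↭-map⁺ (λ k → [ g k ]) σ))))

sumList-map : ∀ {S : Set} (_⊕_ : S → S → S) (g : ℕ → S) (f : ℕ → ℕ) a t →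
  sumList _⊕_ (g ∘ f) a t ≡ sumList _⊕_ g (f a) (map f t)
sumList-map _⊕_ g f a []      = refl
sumList-map _⊕_ g f a (b ∷ t) = cong (g (f a) ⊕_) (sumList-map _⊕_ g f b t)

increasing⇒linked : ∀ {l} → Increasing l → Linked _<_ l
increasing⇒linked {[]}          _           = []
increasing⇒linked {a ∷ []}      _           = [-]
increasing⇒linked {a ∷ b ∷ t}   (a<b , inc) = a<b ∷ increasing⇒linked inc

linked<⇒unique : ∀ {l} → Linked _<_ l → Unique l
linked<⇒unique = AllPairs.map <⇒≢ ∘ Linked⇒AllPairs <-trans

sorted∧unique⇒linked< : ∀ {l} → Linked _≤_ l → Unique l → Linked _<_ l
sorted∧unique⇒linked< []          _                = []
sorted∧unique⇒linked< [-]         _                = [-]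
sorted∧unique⇒linked< (a≤b ∷ srt) ((a≢b ∷ _) ∷ u) = ≤∧≢⇒< a≤b a≢b ∷ sorted∧unique⇒linked< srt u

sort-unique : ∀ a t → Unique (a ∷ t) → Σ[ b ∈ ℕ ] Σ[ u ∈ List ℕ ] (a ∷ t ↭ b ∷ u) × Linked _<_ (b ∷ u)
sort-unique a t uniq with sort (a ∷ t) | sort-↭ (a ∷ t) | sort-↗ (a ∷ t)
... | []    | sorted↭ | _   with () ← ↭-empty-inv (↭-sym sorted↭)
... | b ∷ u | sorted↭ | srt = b , u , ↭-sym sorted↭ ,
  sorted∧unique⇒linked< srt (↭ₛ.Unique-resp-↭ (setoid ℕ) (↭⇒↭ₛ (↭-sym sorted↭)) uniq)

-- Cantor's pairing: (i , j) is the i-th point on the diagonal i + j.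
triangle : ℕ → ℕ
triangle zero    = 0
triangle (suc n) = suc n + triangle n

pair : ℕ → ℕ → ℕ
pair i j = i + triangle (i + j)

triangle-mono-≤ : ∀ {m n} → m ≤ n → triangle m ≤ triangle n
triangle-mono-≤ {zero}          _         = z≤n
triangle-mono-≤ {suc m} {suc n} (s≤s m≤n) = +-mono-≤ (s≤s m≤n) (triangle-mono-≤ m≤n)

m≤pair-m : ∀ i j → i ≤ pair i j
m≤pair-m i j = m≤m+n i (triangle (i + j))

pair-diagonal-< : ∀ i j i′ j′ → i + j < i′ + j′ → pair i j < pair i′ j′
pair-diagonal-< i j i′ j′ d<d′ = begin-strict
  i + triangle (i + j)          <⟨ +-monoˡ-< (triangle (i + j)) (s≤s (m≤m+n i j)) ⟩
  triangle (suc (i + j))        ≤⟨ triangle-mono-≤ d<d′ ⟩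
  triangle (i′ + j′)            ≤⟨ m≤n+m (triangle (i′ + j′)) i′ ⟩
  i′ + triangle (i′ + j′)       ∎
  where open ≤-Reasoning

pair-injective : ∀ {i j i′ j′} → pair i j ≡ pair i′ j′ → i ≡ i′ × j ≡ j′
pair-injective {i} {j} {i′} {j′} eq with <-cmp (i + j) (i′ + j′)
... | tri< d<d′ _ _ = contradiction eq (<⇒≢ (pair-diagonal-< i j i′ j′ d<d′))
... | tri> _ _ d>d′ = contradiction (sym eq) (<⇒≢ (pair-diagonal-< i′ j′ i j d>d′))
... | tri≈ _ d≡d′ _ = i≡i′ , +-cancelˡ-≡ i j j′ (trans d≡d′ (cong (_+ j′) (sym i≡i′)))
  where
  i≡i′ : i ≡ i′
  i≡i′ = +-cancelʳ-≡ (triangle (i + j)) i i′ (trans eq (cong (λ d → i′ + triangle d) (sym d≡d′)))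

pair-injectiveʳ : ∀ i {j j′} → pair i j ≡ pair i j′ → j ≡ j′
pair-injectiveʳ i = proj₂ ∘ pair-injective {i} {_} {i}

module IdempotentUltrafilter {S : Set} (_⊕_ : S → S → S) (assoc : Associative _≡_ _⊕_)
  (p : Pred S 0ℓ → Set) (ultrafilter : IsUltrafilter p) (idempotent : IsIdempotentβ _⊕_ p) where

  open IsUltrafilter ultrafilter

  star : Pred S 0ℓ → Pred S 0ℓ
  star A = A ∩ λ x → p (shift _⊕_ x A)

  star-∈ : ∀ {A} → p A → p (star A)
  star-∈ {A} A∈p = inter A _ A∈p (proj₂ (idempotent A) A∈p)

  shift-star-∈ : ∀ {A x} → star A x → p (shift _⊕_ x (star A))
  shift-star-∈ {A} {x} (_ , -x+A∈p) = inter _ _ -x+A∈p -x+[-x+A]∈p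
    where
    -x+[-x+A]∈p : p (λ y → p (shift _⊕_ (x ⊕ y) A))
    -x+[-x+A]∈p = upward _ _
      (upward _ _ (λ {z} → subst A (sym (assoc x _ z))))
      (proj₂ (idempotent (shift _⊕_ x A)) -x+A∈p)

  module Sequence (C : ℕ → Pred S 0ℓ) (C∈p : ∀ n → p (C n)) where

    B-from : Σ (Pred S 0ℓ) p → ℕ → Pred S 0ℓ
    B-from (D , _) n = star (D ∩ C n)

    B-from∈p : ∀ D n → p (B-from D n)
    B-from∈p (_ , D∈p) n = star-∈ (inter _ _ D∈p (C∈p n))

    y-from : ∀ D n → Σ S (B-from D n)
    y-from D n = inhabited _ (B-from∈p D n)

    domain : ℕ → Σ (Pred S 0ℓ) p
    domain zero    = (λ _ → ⊤) , whole
    domain (suc n) = (Bₙ ∩ shift _⊕_ yₙ Bₙ) , inter _ _ (B-from∈p Dₙ n) (shift-star-∈ {proj₁ Dₙ ∩ C n} yₙ∈Bₙ)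
      where
      Dₙ = domain n
      Bₙ = B-from Dₙ n
      yₙ = proj₁ (y-from Dₙ n)
      yₙ∈Bₙ = proj₂ (y-from Dₙ n)

    B : ℕ → Pred S 0ℓ
    B n = B-from (domain n) n

    y : ℕ → S
    y n = proj₁ (y-from (domain n) n)

    y∈B : ∀ n → B n (y n)
    y∈B n = proj₂ (y-from (domain n) n)

    B⊆C : ∀ n → B n ⊆ C n
    B⊆C n ((_ , z∈C) , _) = z∈C

    B-suc⊆B : ∀ n → B (suc n) ⊆ B n
    B-suc⊆B n ((z∈D , _) , _) = proj₁ z∈D

    B-suc⊆shift : ∀ n → B (suc n) ⊆ shift _⊕_ (y n) (B n)
    B-suc⊆shift n ((z∈D , _) , _) = proj₂ z∈D

    B-antitone : ∀ {m n} → m ≤ n → B n ⊆ B m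
    B-antitone = antitone′ ∘ ≤⇒≤′
      where
      antitone′ : ∀ {m n} → m ≤′ n → B n ⊆ B m
      antitone′ ≤′-refl        z∈B = z∈B
      antitone′ (≤′-step m≤′n) z∈B = antitone′ m≤′n (B-suc⊆B _ z∈B)

    increasing-sum∈B : ∀ {a t} → Linked _<_ (a ∷ t) → B a (sumList _⊕_ y a t)
    increasing-sum∈B {a} [-]         = y∈B a
    increasing-sum∈B {a} (a<b ∷ inc) = B-suc⊆shift a (B-antitone a<b (increasing-sum∈B inc))

module DistinctSums {S : Set} (_⊕_ : S → S → S) (isCS : IsCommutativeSemigroup _≡_ _⊕_)
  (p : Pred S 0ℓ → Set) (ultrafilter : IsUltrafilter p) (idempotent : IsIdempotentβ _⊕_ p)
  (C : ℕ → Pred S 0ℓ) (C∈p : ∀ n → p (C n)) where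

  open IsCommutativeSemigroup isCS using (assoc)
  open IdempotentUltrafilter _⊕_ assoc p ultrafilter idempotent
  open Sequence C C∈p public using (y)
  open Sequence C C∈p using (B⊆C; B-antitone; increasing-sum∈B)

  distinct-sum∈C : ∀ {n a t} → Unique (a ∷ t) → All (n ≤_) (a ∷ t) → C n (sumList _⊕_ y a t)
  distinct-sum∈C {n} {a} {t} uniq n≤ with sort-unique a t uniq
  ... | b , u , σ , inc = subst (C n) (sym (sumList-↭ isCS y σ))
    (B⊆C n (B-antitone (All.head (All-resp-↭ σ n≤)) (increasing-sum∈B inc)))

elements-unique : ∀ F → Unique (hd F ∷ tl F)
elements-unique F = linked<⇒unique (increasing⇒linked (incr F))

min≤elements : ∀ F → All (minPf F ≤_) (hd F ∷ tl F)
min≤elements F with Linked⇒AllPairs <-trans (increasing⇒linked (incr F))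
... | min<tl ∷ _ = ≤-refl ∷ All.map <⇒≤ min<tl

theorem2p5 : {S : Set} (_+_ : S → S → S) → IsCommutativeSemigroup _≡_ _+_ →
    (p : Pred S 0ℓ → Set) → IsUltrafilter p → IsIdempotentβ _+_ p →
    (C : ℕ → Pred S 0ℓ) → (∀ n → p (C n)) →
    Σ (ℕ → ℕ → S) (λ x →
      (∀ (i : ℕ) (H : Pf) → C i (sumPf _+_ (x i) H)) ×
      (∀ (F : Pf) (f : ℕ → ℕ) → C (minPf F) (sumPf _+_ (λ i → x i (f i)) F)))
theorem2p5 {S} _⊕_ isCS p ultrafilter idempotent C C∈p = x , rows , transversals
  where
  open DistinctSums _⊕_ isCS p ultrafilter idempotent C C∈p

  x : ℕ → ℕ → S
  x i j = y (pair i j)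

  rows : ∀ i H → C i (sumPf _⊕_ (x i) H)
  rows i H = subst (C i) (sym (sumList-map _⊕_ y (pair i) (hd H) (tl H)))
    (distinct-sum∈C (Unique.map⁺ (pair-injectiveʳ i) (elements-unique H))
                    (All.map⁺ (All.universal (m≤pair-m i) (hd H ∷ tl H))))

  transversals : ∀ F f → C (minPf F) (sumPf _⊕_ (λ i → x i (f i)) F)
  transversals F f = subst (C (minPf F)) (sym (sumList-map _⊕_ y (λ i → pair i (f i)) (hd F) (tl F)))
    (distinct-sum∈C (Unique.map⁺ (proj₁ ∘ pair-injective) (elements-unique F))
                    (All.map⁺ (All.map (λ {i} min≤i → ≤-trans min≤i (m≤pair-m i (f i))) (min≤elements F))))
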